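{- Let $H(X,Y,E)$ be a complete bipartite $r$-uniform hypergraph with $|X|=|Y|=r$, and let $\delta$ be the degree of each vertex of $H$. Then $ed(H)=\delta$.
   Context: A hypergraph has a finite vertex set and a set of hyperedges, each a subset of the vertex set; it is $r$-uniform if every hyperedge has exactly $r$ vertices. A complete bipartite $r$-uniform hypergraph $H(X,Y,E)$ ($r\ge 2$) has vertex set $X\cup Y$ with $X,Y$ disjoint and nonempty, and its hyperedges are all $r$-element subsets of $X\cup Y$ containing at least one vertex of $X$ and at least one vertex of $Y$. The degree of a vertex is the number of hyperedges containing it. Two distinct hyperedges are adjacent if they share at least one vertex. An edge-dominating set is a subset $E_d\subseteq E$ such that every hyperedge in $E\setminus E_d$ is adjacent to some hyperedge in $E_d$. The edge-domatic number $ed(H)$ is the maximum number of classes in a partition of $E$ into edge-dominating sets. -}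

module Defs where

open import Data.Nat using (ℕ; zero; suc; _+_; _≤_)
open import Data.Nat.Properties using (_≟_)
open import Data.Fin using (Fin; _↑ˡ_; _↑ʳ_)
open import Data.Fin.Subset using (Subset; _∈_; ∣_∣; inside; outside)
open import Data.Fin.Subset.Properties using (_∈?_)
open import Data.Fin.Properties using (any?)
open import Data.Vec using ([]; _∷_)
open import Data.List using (List; []; _∷_; _++_; map; filter; length)
open import Data.Product using (Σ; ∃; ∃-syntax; _×_; _,_)
open import Relation.Nullary using (Dec; ¬_)
open import Relation.Nullary.Decidable using (_×-dec_)
open import Relation.Binary.PropositionalEquality using (_≡_; _≢_)

-- Vertex set of H(X,Y,E) with |X| = |Y| = r : Fin (r + r),
-- X = the first r vertices (i ↑ˡ r), Y = the last r vertices (r ↑ʳ j).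
Vertex : ℕ → Set
Vertex r = Fin (r + r)

inX : (r : ℕ) → Fin r → Vertex r
inX r i = i ↑ˡ r

inY : (r : ℕ) → Fin r → Vertex r
inY r j = r ↑ʳ j

IsEdge : (r : ℕ) → Subset (r + r) → Set
IsEdge r e = (∣ e ∣ ≡ r) × (∃[ i ] (inX r i ∈ e)) × (∃[ j ] (inY r j ∈ e))

isEdge? : (r : ℕ) (e : Subset (r + r)) → Dec (IsEdge r e)
isEdge? r e = (∣ e ∣ ≟ r) ×-dec (any? (λ i → inX r i ∈? e) ×-dec any? (λ j → inY r j ∈? e))

subsets : (n : ℕ) → List (Subset n)
subsets zero = [] ∷ []
subsets (suc n) = map (outside ∷_) (subsets n) ++ map (inside ∷_) (subsets n)

degree : (r : ℕ) → Vertex r → ℕ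
degree r v = length (filter (λ e → isEdge? r e ×-dec (v ∈? e)) (subsets (r + r)))

Adjacent : (r : ℕ) → Subset (r + r) → Subset (r + r) → Set
Adjacent r e f = (e ≢ f) × (∃[ v ] (v ∈ e × v ∈ f))

IsEdgeDominating : (r : ℕ) → (Subset (r + r) → Set) → Set
IsEdgeDominating r D =
  ∀ e → IsEdge r e → ¬ D e → ∃[ f ] (IsEdge r f × D f × Adjacent r e f)

-- A partition of E into k edge-dominating sets, given as a class assignment
-- c (only its values on hyperedges matter); class i is {e ∈ E | c e ≡ i}.
HasEdgeDomaticPartition : (r k : ℕ) → Set
HasEdgeDomaticPartition r k =
  Σ (Subset (r + r) → Fin k) λ c →
    ∀ (i : Fin k) → IsEdgeDominating r (λ e → c e ≡ i)

EdgeDomaticNumberIs : (r d : ℕ) → Set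
EdgeDomaticNumberIs r d =
  HasEdgeDomaticPartition r d × (∀ k → HasEdgeDomaticPartition r k → k ≤ d)

-- Since |X| = |Y| = r, the complement of a hyperedge is again a hyperedge, and two hyperedges are
-- disjoint exactly when they are complementary.  Hence each pair {e, ∁ e} is edge-dominating, and
-- the pairs, indexed by their member through a fixed vertex x₀, partition E into deg x₀ classes.
-- Conversely, an edge-dominating class contains an edge f and, to dominate ∁ f, another edge
-- meeting ∁ f, so k classes use 2k distinct edges; and e ↦ (whether x₀ ∈ e, the member of {e, ∁ e}
-- through x₀) embeds E into two copies of the edges through x₀, so 2k ≤ 2 deg x₀.
module Submission where

open import Defs
open import Data.Nat using (ℕ; zero; suc; _+_; _∸_; _≤_; _<_; z≤n; s≤s)
open import Data.Nat.Properties
  using (+-identityʳ; +-mono-≤-<; +-mono-<-≤; +-mono-<; m+n∸n≡m; <-irrefl; <⇒≱; ≮⇒≥; module ≤-Reasoning)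
open import Data.Bool using (true; false)
open import Data.Bool.Properties using (not-involutive)
open import Data.Fin using (Fin; _↑ˡ_; _↑ʳ_; splitAt; join)
open import Data.Fin.Properties using (any?; injective⇒≤; join-splitAt; splitAt-join)
  renaming (_≟_ to _≟ᶠ_)
open import Data.Fin.Subset using (Subset; _∈_; _∉_; _⊆_; ∣_∣; inside; outside; ∁; ⊤)
open import Data.Fin.Subset.Properties
  using (_∈?_; ⊆-antisym; p⊆q⇒∣p∣≤∣q∣; p⊂q⇒∣p∣<∣q∣; ∣⁅x⁆∣≡1; x∈⁅y⁆⇒x≡y; ∣⊤∣≡n; ∣⊥∣≡0;
         ∣∁p∣≡n∸∣p∣; x∈∁p⇒x∉p; x∉∁p⇒x∈p; x∉p⇒x∈∁p; x∈p⇒x∉∁p)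
open import Data.Vec using ([]; _∷_; here; there; replicate) renaming (_++_ to _++ᵛ_; splitAt to splitAtᵛ)
open import Data.Vec.Properties using (∷-injectiveʳ; lookup-++ˡ; lookup-++ʳ; []=⇒lookup; lookup⇒[]=)
open import Data.List using (List; filter; length; lookup; map)
open import Data.List.Membership.Propositional using () renaming (_∈_ to _∈ˡ_)
open import Data.List.Membership.Propositional.Properties
  using (∈-map⁺; ∈-map⁻; ∈-++⁺ˡ; ∈-++⁺ʳ; ∈-filter⁺; ∈-filter⁻; ∈-lookup)
open import Data.List.Relation.Unary.Any using (here; there; index)
open import Data.List.Relation.Unary.Any.Properties using (lookup-index)
open import Data.List.Relation.Unary.All using ([]; _∷_) renaming (lookup to lookupᴬ)
open import Data.List.Relation.Unary.AllPairs using ([]; _∷_)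
open import Data.List.Relation.Unary.Unique.Propositional using (Unique)
import Data.List.Relation.Unary.Unique.Propositional.Properties as Unique
open import Data.Product using (∃₂; ∃-syntax; _×_; _,_; proj₁; proj₂)
open import Data.Sum using (_⊎_; inj₁; inj₂; reduce)
open import Data.Sum.Properties using (inj₁-injective; inj₂-injective)
open import Data.Empty using (⊥-elim)
open import Function using (_∘_)
open import Relation.Nullary using (yes; no; ¬_; ¬?)
open import Relation.Nullary.Decidable using (_×-dec_)
open import Relation.Unary using (Pred; Decidable)
open import Relation.Binary.PropositionalEquality

lookup-injective : ∀ {a} {A : Set a} {xs : List A} → Unique xs →
                   ∀ i j → lookup xs i ≡ lookup xs j → i ≡ j
lookup-injective (_ ∷ _)          Fin.zero    Fin.zero    _  = refl
lookup-injective (x∉xs ∷ _)       Fin.zero    (Fin.suc j) eq = ⊥-elim (lookupᴬ x∉xs (∈-lookup j) eq)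
lookup-injective (x∉xs ∷ _)       (Fin.suc i) Fin.zero    eq = ⊥-elim (lookupᴬ x∉xs (∈-lookup i) (sym eq))
lookup-injective (_ ∷ unique)     (Fin.suc i) (Fin.suc j) eq = cong Fin.suc (lookup-injective unique i j eq)

∈-subsets : ∀ n (p : Subset n) → p ∈ˡ subsets n
∈-subsets zero    []          = here refl
∈-subsets (suc n) (false ∷ p) = ∈-++⁺ˡ (∈-map⁺ (false ∷_) (∈-subsets n p))
∈-subsets (suc n) (true ∷ p)  = ∈-++⁺ʳ (map (outside ∷_) (subsets n)) (∈-map⁺ (true ∷_) (∈-subsets n p))

subsets-unique : ∀ n → Unique (subsets n)
subsets-unique zero    = [] ∷ []
subsets-unique (suc n) =
  Unique.++⁺ (Unique.map⁺ ∷-injectiveʳ (subsets-unique n)) (Unique.map⁺ ∷-injectiveʳ (subsets-unique n))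
             heads-differ
  where
  heads-differ : ∀ {p} → ¬ (p ∈ˡ map (outside ∷_) (subsets n) × p ∈ˡ map (inside ∷_) (subsets n))
  heads-differ (out , in′) with ∈-map⁻ (outside ∷_) out | ∈-map⁻ (inside ∷_) in′
  ... | _ , _ , refl | _ , _ , ()

module _ {a p} {A : Set a} {P : Pred A p} {k m : ℕ}
         (slot : A → Fin m) (slot-injective : ∀ {x y} → P x → P y → slot x ≡ slot y → x ≡ y)
         (cls : A → Fin k) (two : ∀ i → ∃₂ λ x y → P x × P y × cls x ≡ i × cls y ≡ i × x ≢ y)
         where

  private
    pick : Fin k ⊎ Fin k → A
    pick (inj₁ i) = proj₁ (two i)
    pick (inj₂ i) = proj₁ (proj₂ (two i))

    pick-P : ∀ a → P (pick a)
    pick-P (inj₁ i) with two i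
    ... | _ , _ , Px , _ = Px
    pick-P (inj₂ i) with two i
    ... | _ , _ , _ , Py , _ = Py

    cls-pick : ∀ a → cls (pick a) ≡ reduce a
    cls-pick (inj₁ i) with two i
    ... | _ , _ , _ , _ , cls-x , _ = cls-x
    cls-pick (inj₂ i) with two i
    ... | _ , _ , _ , _ , _ , cls-y , _ = cls-y

    pick-distinct : ∀ i → pick (inj₁ i) ≢ pick (inj₂ i)
    pick-distinct i with two i
    ... | _ , _ , _ , _ , _ , _ , x≢y = x≢y

    same-class : ∀ a b → pick a ≡ pick b → reduce a ≡ reduce b
    same-class a b eq = trans (sym (cls-pick a)) (trans (cong cls eq) (cls-pick b))

    pick-injective : ∀ a b → pick a ≡ pick b → a ≡ b
    pick-injective (inj₁ i) (inj₁ j) eq = cong inj₁ (same-class (inj₁ i) (inj₁ j) eq)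
    pick-injective (inj₂ i) (inj₂ j) eq = cong inj₂ (same-class (inj₂ i) (inj₂ j) eq)
    pick-injective (inj₁ i) (inj₂ j) eq with refl ← same-class (inj₁ i) (inj₂ j) eq = ⊥-elim (pick-distinct i eq)
    pick-injective (inj₂ i) (inj₁ j) eq with refl ← same-class (inj₂ i) (inj₁ j) eq = ⊥-elim (pick-distinct i (sym eq))

  two-per-class⇒k+k≤m : k + k ≤ m
  two-per-class⇒k+k≤m = injective⇒≤ {f = slot ∘ pick ∘ splitAt k} λ {x} {y} eq →
    trans (sym (join-splitAt k k x))
          (trans (cong (join k k) (pick-injective (splitAt k x) (splitAt k y)
                                     (slot-injective (pick-P (splitAt k x)) (pick-P (splitAt k y)) eq)))
                 (join-splitAt k k y))

m+m≤n+n⇒m≤n : ∀ {m n} → m + m ≤ n + n → m ≤ n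
m+m≤n+n⇒m≤n le = ≮⇒≥ λ n<m → <⇒≱ (+-mono-< n<m n<m) le

∁-involutive : ∀ {n} (p : Subset n) → ∁ (∁ p) ≡ p
∁-involutive []      = refl
∁-involutive (b ∷ p) = cong₂ _∷_ (not-involutive b) (∁-involutive p)

∁-injective : ∀ {n} {p q : Subset n} → ∁ p ≡ ∁ q → p ≡ q
∁-injective {p = p} {q} eq = trans (sym (∁-involutive p)) (trans (cong ∁ eq) (∁-involutive q))

∣p++q∣ : ∀ {m n} (p : Subset m) (q : Subset n) → ∣ p ++ᵛ q ∣ ≡ ∣ p ∣ + ∣ q ∣
∣p++q∣ []          q = refl
∣p++q∣ (true ∷ p)  q = cong suc (∣p++q∣ p q)
∣p++q∣ (false ∷ p) q = ∣p++q∣ p q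

module _ {m n : ℕ} (p : Subset m) (q : Subset n) where

  ∈-++ᵛ⁻ˡ : ∀ i → i ↑ˡ n ∈ p ++ᵛ q → i ∈ p
  ∈-++ᵛ⁻ˡ i i∈ = lookup⇒[]= i p (trans (sym (lookup-++ˡ p q i)) ([]=⇒lookup i∈))

  ∈-++ᵛ⁻ʳ : ∀ j → m ↑ʳ j ∈ p ++ᵛ q → j ∈ q
  ∈-++ᵛ⁻ʳ j j∈ = lookup⇒[]= j q (trans (sym (lookup-++ʳ p q j)) ([]=⇒lookup j∈))

  ∈-++ᵛ⁺ʳ : ∀ j → j ∈ q → m ↑ʳ j ∈ p ++ᵛ q
  ∈-++ᵛ⁺ʳ j j∈ = lookup⇒[]= (m ↑ʳ j) (p ++ᵛ q) (trans (lookup-++ʳ p q j) ([]=⇒lookup j∈))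

x∈p⇒0<∣p∣ : ∀ {n} {x : Fin n} {p : Subset n} → x ∈ p → 0 < ∣ p ∣
x∈p⇒0<∣p∣ {x = x} {p} x∈p =
  subst (_≤ ∣ p ∣) (∣⁅x⁆∣≡1 x) (p⊆q⇒∣p∣≤∣q∣ λ y∈⁅x⁆ → subst (_∈ p) (sym (x∈⁅y⁆⇒x≡y x y∈⁅x⁆)) x∈p)

⊆∧∣p∣≡∣q∣⇒p≡q : ∀ {n} {p q : Subset n} → p ⊆ q → ∣ p ∣ ≡ ∣ q ∣ → p ≡ q
⊆∧∣p∣≡∣q∣⇒p≡q {p = p} {q} p⊆q eq with any? (λ x → (x ∈? q) ×-dec ¬? (x ∈? p))
... | yes new = ⊥-elim (<-irrefl eq (p⊂q⇒∣p∣<∣q∣ (p⊆q , new)))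
... | no ¬new = ⊆-antisym p⊆q q⊆p
  where
  q⊆p : q ⊆ p
  q⊆p {x} x∈q with x ∈? p
  ... | yes x∈p = x∈p
  ... | no  x∉p = ⊥-elim (¬new (x , x∈q , x∉p))

module _ {m n : ℕ} (p : Subset (m + n)) where

  ↑ˡ-full⇒m<∣p∣ : (∀ i → i ↑ˡ n ∈ p) → ∃[ j ] (m ↑ʳ j ∈ p) → m < ∣ p ∣
  ↑ˡ-full⇒m<∣p∣ full (j , j∈p) with splitAtᵛ m p
  ... | xs , ys , refl = begin-strict
    m                 ≡⟨ sym (+-identityʳ m) ⟩
    m + 0             <⟨ +-mono-≤-< m≤∣xs∣ (x∈p⇒0<∣p∣ (∈-++ᵛ⁻ʳ xs ys j j∈p)) ⟩
    ∣ xs ∣ + ∣ ys ∣   ≡⟨ sym (∣p++q∣ xs ys) ⟩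
    ∣ xs ++ᵛ ys ∣     ∎
    where
    open ≤-Reasoning
    m≤∣xs∣ : m ≤ ∣ xs ∣
    m≤∣xs∣ = subst (_≤ ∣ xs ∣) (∣⊤∣≡n m) (p⊆q⇒∣p∣≤∣q∣ {p = ⊤} λ {i} _ → ∈-++ᵛ⁻ˡ xs ys i (full i))

  ↑ʳ-full⇒n<∣p∣ : (∀ j → m ↑ʳ j ∈ p) → ∃[ i ] (i ↑ˡ n ∈ p) → n < ∣ p ∣
  ↑ʳ-full⇒n<∣p∣ full (i , i∈p) with splitAtᵛ m p
  ... | xs , ys , refl = begin-strict
    n                 ≡⟨⟩
    0 + n             <⟨ +-mono-<-≤ (x∈p⇒0<∣p∣ (∈-++ᵛ⁻ˡ xs ys i i∈p)) n≤∣ys∣ ⟩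
    ∣ xs ∣ + ∣ ys ∣   ≡⟨ sym (∣p++q∣ xs ys) ⟩
    ∣ xs ++ᵛ ys ∣     ∎
    where
    open ≤-Reasoning
    n≤∣ys∣ : n ≤ ∣ ys ∣
    n≤∣ys∣ = subst (_≤ ∣ ys ∣) (∣⊤∣≡n n) (p⊆q⇒∣p∣≤∣q∣ {p = ⊤} λ {j} _ → ∈-++ᵛ⁻ʳ xs ys j (full j))

Meets : ∀ {n} → Subset n → Subset n → Set
Meets e f = ∃[ v ] (v ∈ e × v ∈ f)

module _ {r : ℕ} where

  ∣∁e∣≡r : (e : Subset (r + r)) → ∣ e ∣ ≡ r → ∣ ∁ e ∣ ≡ r
  ∣∁e∣≡r e ∣e∣≡r = trans (∣∁p∣≡n∸∣p∣ e) (trans (cong (r + r ∸_) ∣e∣≡r) (m+n∸n≡m r r))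

  IsEdge-∁ : {e : Subset (r + r)} → IsEdge r e → IsEdge r (∁ e)
  IsEdge-∁ {e} (∣e∣≡r , x∈e , y∈e) = ∣∁e∣≡r e ∣e∣≡r , x∈∁e , y∈∁e
    where
    x∈∁e : ∃[ i ] (inX r i ∈ ∁ e)
    x∈∁e with any? (λ i → inX r i ∈? ∁ e)
    ... | yes found = found
    ... | no ¬found = ⊥-elim (<-irrefl (sym ∣e∣≡r)
                        (↑ˡ-full⇒m<∣p∣ e (λ i → x∉∁p⇒x∈p (λ i∈∁e → ¬found (i , i∈∁e))) y∈e))
    y∈∁e : ∃[ j ] (inY r j ∈ ∁ e)
    y∈∁e with any? (λ j → inY r j ∈? ∁ e)
    ... | yes found = found
    ... | no ¬found = ⊥-elim (<-irrefl (sym ∣e∣≡r)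
                        (↑ʳ-full⇒n<∣p∣ e (λ j → x∉∁p⇒x∈p (λ j∈∁e → ¬found (j , j∈∁e))) x∈e))

  disjoint-edges-complementary : {e f : Subset (r + r)} → IsEdge r e → IsEdge r f → ¬ Meets e f → e ≡ ∁ f
  disjoint-edges-complementary {f = f} (∣e∣≡r , _) (∣f∣≡r , _) ¬meet =
    ⊆∧∣p∣≡∣q∣⇒p≡q (λ {x} x∈e → x∉p⇒x∈∁p λ x∈f → ¬meet (x , x∈e , x∈f)) (trans ∣e∣≡r (sym (∣∁e∣≡r f ∣f∣≡r)))

  meets-dominating : {D : Subset (r + r) → Set} → IsEdgeDominating r D → Decidable D →
                     {e : Subset (r + r)} → IsEdge r e → ∃[ f ] (IsEdge r f × D f × Meets e f)
  meets-dominating dom D? {e} e-edge@(_ , (i , i∈e) , _) with D? e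
  ... | yes De = e , e-edge , De , inX r i , i∈e , i∈e
  ... | no ¬De with dom e e-edge ¬De
  ...   | f , f-edge , Df , _ , meet = f , f-edge , Df , meet

  -- D contains an edge f, and the edge of D meeting ∁ f cannot be f.
  dominating-has-two-edges : {D : Subset (r + r) → Set} → IsEdgeDominating r D → Decidable D →
                             {e : Subset (r + r)} → IsEdge r e →
                             ∃₂ λ f g → IsEdge r f × IsEdge r g × D f × D g × f ≢ g
  dominating-has-two-edges dom D? e-edge with meets-dominating dom D? e-edge
  ... | f , f-edge , Df , _ with meets-dominating dom D? (IsEdge-∁ f-edge)
  ...   | g , g-edge , Dg , v , v∈∁f , v∈g =
    f , g , f-edge , g-edge , Df , Dg , λ { refl → x∈∁p⇒x∉p v∈∁f v∈g }

module Pairs (r : ℕ) (x₀ : Vertex r) (e₀ : Subset (r + r)) (e₀-edge : IsEdge r e₀) (x₀∈e₀ : x₀ ∈ e₀) where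

  Through : Subset (r + r) → Set
  Through e = IsEdge r e × x₀ ∈ e

  through? : Decidable Through
  through? e = isEdge? r e ×-dec (x₀ ∈? e)

  L : List (Subset (r + r))
  L = filter through? (subsets (r + r))

  δ : ℕ
  δ = length L

  ∈L : ∀ {e} → Through e → e ∈ˡ L
  ∈L {e} = ∈-filter⁺ through? (∈-subsets (r + r) e)

  rep : Subset (r + r) → Subset (r + r)
  rep e with x₀ ∈? e
  ... | yes _ = e
  ... | no  _ = ∁ e

  rep-∈ : ∀ {e} → x₀ ∈ e → rep e ≡ e
  rep-∈ {e} x₀∈e with x₀ ∈? e
  ... | yes _    = refl
  ... | no x₀∉e = ⊥-elim (x₀∉e x₀∈e)

  rep-∉ : ∀ {e} → x₀ ∉ e → rep e ≡ ∁ e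
  rep-∉ {e} x₀∉e with x₀ ∈? e
  ... | yes x₀∈e = ⊥-elim (x₀∉e x₀∈e)
  ... | no  _    = refl

  rep-through : ∀ {e} → IsEdge r e → Through (rep e)
  rep-through {e} e-edge with x₀ ∈? e
  ... | yes x₀∈e = e-edge , x₀∈e
  ... | no  x₀∉e = IsEdge-∁ e-edge , x∉p⇒x∈∁p x₀∉e

  rep-∁ : ∀ e → rep (∁ e) ≡ rep e
  rep-∁ e with x₀ ∈? e
  ... | yes x₀∈e = trans (rep-∉ (x∈p⇒x∉∁p x₀∈e)) (∁-involutive e)
  ... | no  x₀∉e = rep-∈ (x∉p⇒x∈∁p x₀∉e)

  L-unique : Unique L
  L-unique = Unique.filter⁺ through? (subsets-unique (r + r))

  through-lookup : ∀ i → Through (lookup L i)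
  through-lookup i = proj₂ (∈-filter⁻ through? {xs = subsets (r + r)} (∈-lookup i))

  -- The class of a hyperedge e is the position in L of its pair's member through x₀; off E the
  -- value is irrelevant, and e₀ just supplies one.
  class : Subset (r + r) → Fin δ
  class e with through? (rep e)
  ... | yes through = index (∈L through)
  ... | no  _       = index (∈L (e₀-edge , x₀∈e₀))

  lookup-class : ∀ {e} → IsEdge r e → lookup L (class e) ≡ rep e
  lookup-class {e} e-edge with through? (rep e)
  ... | yes through = sym (lookup-index (∈L through))
  ... | no ¬through = ⊥-elim (¬through (rep-through e-edge))

  rep≡⇒class≡ : ∀ {e f} → IsEdge r e → IsEdge r f → rep e ≡ rep f → class e ≡ class f
  rep≡⇒class≡ e-edge f-edge eq =
    lookup-injective L-unique _ _ (trans (lookup-class e-edge) (trans eq (sym (lookup-class f-edge))))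

  class≡⇒rep≡ : ∀ {e f} → IsEdge r e → IsEdge r f → class e ≡ class f → rep e ≡ rep f
  class≡⇒rep≡ e-edge f-edge eq = trans (sym (lookup-class e-edge)) (trans (cong (lookup L) eq) (lookup-class f-edge))

  class-lookup : ∀ i → class (lookup L i) ≡ i
  class-lookup i with through-lookup i
  ... | f-edge , x₀∈f = lookup-injective L-unique _ _ (trans (lookup-class f-edge) (rep-∈ x₀∈f))

  pairs-dominating : ∀ i → IsEdgeDominating r (λ e → class e ≡ i)
  pairs-dominating i e e-edge class≢i with through-lookup i | any? (λ v → (v ∈? e) ×-dec (v ∈? lookup L i))
  ... | f-edge , _ | yes meet = lookup L i , f-edge , class-lookup i , (λ { refl → class≢i (class-lookup i) }) , meet
  ... | f-edge , _ | no ¬meet = ⊥-elim (class≢i (trans (rep≡⇒class≡ e-edge f-edge same-pair) (class-lookup i)))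
    where
    same-pair : rep e ≡ rep (lookup L i)
    same-pair = trans (cong rep (disjoint-edges-complementary e-edge f-edge ¬meet)) (rep-∁ (lookup L i))

  tag : Subset (r + r) → Fin δ ⊎ Fin δ
  tag e with x₀ ∈? e
  ... | yes _ = inj₁ (class e)
  ... | no  _ = inj₂ (class e)

  tag-injective : ∀ {e f} → IsEdge r e → IsEdge r f → tag e ≡ tag f → e ≡ f
  tag-injective {e} {f} e-edge f-edge eq with x₀ ∈? e | x₀ ∈? f
  ... | yes x₀∈e | yes x₀∈f = begin
    e      ≡⟨ sym (rep-∈ x₀∈e) ⟩
    rep e  ≡⟨ class≡⇒rep≡ e-edge f-edge (inj₁-injective eq) ⟩
    rep f  ≡⟨ rep-∈ x₀∈f ⟩
    f      ∎
    where open ≡-Reasoning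
  ... | no x₀∉e  | no x₀∉f  = ∁-injective (begin
    ∁ e    ≡⟨ sym (rep-∉ x₀∉e) ⟩
    rep e  ≡⟨ class≡⇒rep≡ e-edge f-edge (inj₂-injective eq) ⟩
    rep f  ≡⟨ rep-∉ x₀∉f ⟩
    ∁ f    ∎)
    where open ≡-Reasoning
  ... | yes _    | no _     with () ← eq
  ... | no _     | yes _    with () ← eq

  bounded-by-δ : ∀ k → HasEdgeDomaticPartition r k → k ≤ δ
  bounded-by-δ k (cls , dominating) = m+m≤n+n⇒m≤n
    (two-per-class⇒k+k≤m (join δ δ ∘ tag) slot-injective cls
      (λ i → dominating-has-two-edges (dominating i) (λ e → cls e ≟ᶠ i) e₀-edge))
    where
    slot-injective : ∀ {e f} → IsEdge r e → IsEdge r f → join δ δ (tag e) ≡ join δ δ (tag f) → e ≡ f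
    slot-injective e-edge f-edge eq = tag-injective e-edge f-edge
      (trans (sym (splitAt-join δ δ _)) (trans (cong (splitAt δ) eq) (splitAt-join δ δ _)))

  edge-domatic-number : EdgeDomaticNumberIs r δ
  edge-domatic-number = (class , pairs-dominating) , bounded-by-δ

lemma7 : (r : ℕ) → 2 ≤ r → (δ : ℕ) → ((v : Vertex r) → degree r v ≡ δ) →
         EdgeDomaticNumberIs r δ
lemma7 (suc (suc m)) (s≤s (s≤s z≤n)) δ deg =
  subst (EdgeDomaticNumberIs r) (deg x₀) (Pairs.edge-domatic-number r x₀ e₀ e₀-edge here)
  where
  r : ℕ
  r = suc (suc m)
  x₀ : Vertex r
  x₀ = inX r Fin.zero
  -- e₀ = {x₀} ∪ (Y ∖ {y₀}); any edge through x₀ would do.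
  xs ys : Subset r
  xs = true ∷ replicate (suc m) false
  ys = false ∷ replicate (suc m) true
  e₀ : Subset (r + r)
  e₀ = xs ++ᵛ ys
  e₀-edge : IsEdge r e₀
  e₀-edge = trans (∣p++q∣ xs ys) (cong₂ (λ a b → suc a + b) (∣⊥∣≡0 (suc m)) (∣⊤∣≡n (suc m)))
          , (Fin.zero , here)
          , (Fin.suc Fin.zero , ∈-++ᵛ⁺ʳ xs ys (Fin.suc Fin.zero) (there here))
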